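{- Let $n\ge 2$. A flip between matchings of $\mathcal{M}_n$ is centered if and only if the sum of the lengths of the four edges of the corresponding quadrilateral equals $n-2$, and it is non-centered if and only if this sum is strictly less than $n-2$.
   Context: Place $2n$ points equidistantly on the unit circle. $\mathcal{M}_n$ is the set of all non-crossing straight-line perfect matchings on these points. For $M\in\mathcal{M}_n$, two edges $e,f\in M$ span an empty quadrilateral if the convex hull of $e$ and $f$ contains no other edge of $M$; replacing $e,f$ by the other two edges of this quadrilateral yields a matching $M'\in\mathcal{M}_n$ (a flip). A flip is centered if the closed quadrilateral contains the center of the circle (possibly on its boundary). For a matching $M$ and $e\in M$, the length $\ell(e)$ is the minimum, over the two sides of the line through $e$, of the number of other edges of $M$ lying on that side. The lengths of the two edges of the quadrilateral belonging to $M$ are measured in $M$, and those of the two edges belonging to $M'$ are measured in $M'$. -}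

module Defs where

open import Data.Nat using (ℕ; zero; suc; _+_; _*_; _∸_; _≤_; _<_; _⊓_)
open import Data.Fin using (Fin; toℕ)
open import Data.Bool using (Bool; true; false; _∧_; _∨_; if_then_else_)
open import Data.List using (List; []; _∷_; _++_)
open import Data.List.Relation.Unary.All using (All)
open import Data.List.Membership.Propositional using (_∈_)
open import Data.List.Relation.Binary.Permutation.Propositional using (_↭_)
open import Data.Product using (_×_; _,_; proj₁; proj₂)
open import Data.Sum using (_⊎_)
open import Relation.Binary.PropositionalEquality using (_≡_; _≢_)
open import Relation.Nullary using (¬_)

-- The 2n points on the circle are labelled 0,1,…,2n-1 in cyclic order
-- (point k sits at angle k·π/n).
record Point (n : ℕ) : Set where
  constructor pt
  field
    label : Fin (2 * n)

val : ∀ {n} → Point n → ℕ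
val p = toℕ (Point.label p)

-- A straight-line edge (chord) between points a and b, stored as (a , b) with a < b.
Edge : ℕ → Set
Edge n = Point n × Point n

_<ᵖ_ : ∀ {n} → Point n → Point n → Bool
a <ᵖ b = val a Data.Nat.<ᵇ val b

_=ᵖ_ : ∀ {n} → Point n → Point n → Bool
a =ᵖ b = val a Data.Nat.≡ᵇ val b

count : ∀ {A : Set} → (A → Bool) → List A → ℕ
count p [] = 0
count p (x ∷ xs) = if p x then suc (count p xs) else count p xs

touches : ∀ {n} → Point n → Edge n → Bool
touches p (a , b) = (p =ᵖ a) ∨ (p =ᵖ b)

-- Two chords (a,b), (c,d) (a<b, c<d) cross iff their endpoints interleave.
Cross : ∀ {n} → Edge n → Edge n → Set
Cross (a , b) (c , d) =
  (val a < val c × val c < val b × val b < val d) ⊎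
  (val c < val a × val a < val d × val d < val b)

record IsNCMatching (n : ℕ) (M : List (Edge n)) : Set where
  field
    ordered     : All (λ e → val (proj₁ e) < val (proj₂ e)) M
    perfect     : (p : Point n) → count (touches p) M ≡ 1
    noncrossing : ∀ {e f} → e ∈ M → f ∈ M → ¬ Cross e f

-- Length ℓ(e) of an edge e = (a,b) in the matching M: the minimum, over the
-- two sides of the line through e, of the number of other edges of M lying
-- on that side.  The open side containing the points strictly between a and b,
-- and the side containing the points outside [a,b].
strictlyInside : ∀ {n} → Edge n → Edge n → Bool
strictlyInside (a , b) (c , d) = (a <ᵖ c) ∧ (d <ᵖ b)

strictlyOutside : ∀ {n} → Edge n → Edge n → Bool
strictlyOutside (a , b) (c , d) =
  (d <ᵖ a) ∨ (b <ᵖ c) ∨ ((c <ᵖ a) ∧ (b <ᵖ d))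

len : ∀ {n} → List (Edge n) → Edge n → ℕ
len M e = count (strictlyInside e) M ⊓ count (strictlyOutside e) M

-- Quadrilateral with vertices p₁ < p₂ < p₃ < p₄.  Its four open boundary
-- arcs of the circle are numbered 1:(p₁,p₂), 2:(p₂,p₃), 3:(p₃,p₄), 4:(p₄,p₁).
arcOf : ∀ {n} → Point n → Point n → Point n → Point n → Point n → ℕ
arcOf p₁ p₂ p₃ p₄ x =
  if (p₁ <ᵖ x) ∧ (x <ᵖ p₂) then 1 else
  if (p₂ <ᵖ x) ∧ (x <ᵖ p₃) then 2 else
  if (p₃ <ᵖ x) ∧ (x <ᵖ p₄) then 3 else 4

-- An edge g (with no endpoint among the p's) meets the convex hull of the
-- quadrilateral iff its endpoints lie on different boundary arcs.
MeetsQuad : ∀ {n} → Point n → Point n → Point n → Point n → Edge n → Set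
MeetsQuad p₁ p₂ p₃ p₄ (x , y) = arcOf p₁ p₂ p₃ p₄ x ≢ arcOf p₁ p₂ p₃ p₄ y

data Shape : Set where
  nested parallel : Shape

oldEdges newEdges : ∀ {n} → Shape → Point n → Point n → Point n → Point n → List (Edge n)
oldEdges nested   p₁ p₂ p₃ p₄ = (p₁ , p₄) ∷ (p₂ , p₃) ∷ []
oldEdges parallel p₁ p₂ p₃ p₄ = (p₁ , p₂) ∷ (p₃ , p₄) ∷ []
newEdges nested   p₁ p₂ p₃ p₄ = (p₁ , p₂) ∷ (p₃ , p₄) ∷ []
newEdges parallel p₁ p₂ p₃ p₄ = (p₁ , p₄) ∷ (p₂ , p₃) ∷ []

-- A flip from M to M': two edges e,f of M spanning an empty quadrilateral
-- (no other edge of M meets its convex hull) are replaced by the other two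
-- sides of the quadrilateral; all other edges (rest) are kept.
record Flip {n : ℕ} (M M' : List (Edge n)) : Set where
  field
    p₁ p₂ p₃ p₄ : Point n
    p₁<p₂ : val p₁ < val p₂
    p₂<p₃ : val p₂ < val p₃
    p₃<p₄ : val p₃ < val p₄
    shape : Shape
    rest  : List (Edge n)
    old   : M  ↭ oldEdges shape p₁ p₂ p₃ p₄ ++ rest
    new   : M' ↭ newEdges shape p₁ p₂ p₃ p₄ ++ rest
    empty : All (λ g → ¬ MeetsQuad p₁ p₂ p₃ p₄ g) rest

  lengthSum : ℕ
  lengthSum = sumLen M (oldEdges shape p₁ p₂ p₃ p₄) + sumLen M' (newEdges shape p₁ p₂ p₃ p₄)
    where
    sumLen : List (Edge n) → List (Edge n) → ℕ
    sumLen N [] = 0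
    sumLen N (e ∷ es) = len N e + sumLen N es

  -- The closed quadrilateral p₁p₂p₃p₄ contains the centre iff no open
  -- semicircle contains all four vertices, i.e. iff every one of the four
  -- arcs between cyclically consecutive vertices spans at most n steps
  -- (each step being the angle π/n).
  Centered : Set
  Centered = (val p₂ ∸ val p₁ ≤ n) × (val p₃ ∸ val p₂ ≤ n)
           × (val p₄ ∸ val p₃ ≤ n) × (2 * n ∸ (val p₄ ∸ val p₁) ≤ n)

-- In a non-crossing perfect matching of the 2n points, every point strictly on one side of
-- an edge is matched on that side.  So an edge whose endpoints are s steps apart has
-- (s - 1)/2 edges on one side and (2n - s - 1)/2 on the other: its length depends only on s.
-- The quadrilateral cuts the circle into four arcs of odd spans d₁ + d₂ + d₃ + d₄ = 2n; with
-- dᵢ = 2xᵢ + 1 the quadrilateral edge across arc i has length min(xᵢ, n - 1 - xᵢ) ≤ xᵢ, with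
-- equality iff dᵢ ≤ n.  Since Σ xᵢ = n - 2, the four lengths sum to at most n - 2, with
-- equality iff no arc exceeds a half circle, i.e. iff the quadrilateral contains the centre.
module Submission where

open import Defs
open import Data.Nat using (ℕ; zero; suc; _+_; _*_; _∸_; _⊓_; _≤_; _<_; _<ᵇ_; _≡ᵇ_; s≤s; s≤s⁻¹)
open import Data.Nat.Properties
open import Data.Nat.Tactic.RingSolver using (solve-∀)
open import Algebra.Properties.CommutativeSemigroup +-commutativeSemigroup using (interchange)
open import Data.Bool using (Bool; true; false; _∧_; _∨_)
open import Data.Bool.Properties using (T-≡; ∧-zeroʳ; ∨-zeroʳ)
open import Data.Fin using (fromℕ<)
open import Data.Fin.Properties using (toℕ<n; toℕ-fromℕ<)
open import Data.List using (List; []; _∷_; map; downFrom)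
open import Data.Nat.ListAction using (sum)
open import Data.List.Properties using (map-cong; map-cong-local)
open import Data.List.Relation.Unary.All as All using (All; []; _∷_)
open import Data.List.Relation.Unary.All.Properties using (applyDownFrom⁺₁)
open import Data.List.Relation.Unary.Any using (here; there)
open import Data.List.Membership.Propositional using (_∈_)
open import Data.List.Relation.Binary.Permutation.Propositional using (_↭_; ↭-sym)
open import Data.List.Relation.Binary.Permutation.Propositional.Properties using (∈-resp-↭)
open import Data.Product using (_×_; _,_; proj₁; proj₂)
open import Data.Sum using (inj₁; inj₂)
open import Function using (_∘_; id)
open import Function.Bundles using (_⇔_; mk⇔; module Equivalence)
open import Relation.Nullary using (¬_; contradiction)
open import Relation.Nullary.Reflects using (Reflects; ofʸ; ofⁿ; fromEquivalence)
open import Relation.Binary using (tri<; tri≈; tri>)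
open import Relation.Binary.PropositionalEquality
  using (_≡_; _≢_; ≢-sym; refl; sym; trans; cong; cong₂; subst; subst₂; module ≡-Reasoning)

iverson : Bool → ℕ
iverson true  = 1
iverson false = 0

<ᵇ-true : ∀ {m n} → m < n → (m <ᵇ n) ≡ true
<ᵇ-true m<n = Equivalence.to T-≡ (<⇒<ᵇ m<n)

<ᵇ-false : ∀ {m n} → n ≤ m → (m <ᵇ n) ≡ false
<ᵇ-false {m} {n} n≤m with m <ᵇ n | <ᵇ-reflects-< m n
... | false | _       = refl
... | true  | ofʸ m<n = contradiction n≤m (<⇒≱ m<n)

≡ᵇ-reflects-≡ : ∀ m n → Reflects (m ≡ n) (m ≡ᵇ n)
≡ᵇ-reflects-≡ m n = fromEquivalence (≡ᵇ⇒≡ m n) (≡⇒≡ᵇ m n)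

≡ᵇ-refl : ∀ n → (n ≡ᵇ n) ≡ true
≡ᵇ-refl n = Equivalence.to T-≡ (≡⇒≡ᵇ n n refl)

≡ᵇ-false : ∀ {m n} → m ≢ n → (m ≡ᵇ n) ≡ false
≡ᵇ-false {m} {n} m≢n with m ≡ᵇ n | ≡ᵇ-reflects-≡ m n
... | false | _        = refl
... | true  | ofʸ m≡n = contradiction m≡n m≢n

≡ᵇ-false⇒≢ : ∀ {m n} → (m ≡ᵇ n) ≡ false → m ≢ n
≡ᵇ-false⇒≢ {m} eq refl = contradiction (trans (sym (≡ᵇ-refl m)) eq) λ ()

∨-false : ∀ {b c} → (b ∨ c) ≡ false → b ≡ false × c ≡ false
∨-false {false} {false} _ = refl , refl

module _ {A : Set} where

  count-∷ : ∀ (p : A → Bool) x xs → count p (x ∷ xs) ≡ iverson (p x) + count p xs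
  count-∷ p x xs with p x
  ... | true  = refl
  ... | false = refl

  count≡sum : ∀ (p : A → Bool) xs → count p xs ≡ sum (map (iverson ∘ p) xs)
  count≡sum p []       = refl
  count≡sum p (x ∷ xs) = trans (count-∷ p x xs) (cong (iverson (p x) +_) (count≡sum p xs))

  count-cong : ∀ {p q : A → Bool} → (∀ x → p x ≡ q x) → ∀ xs → count p xs ≡ count q xs
  count-cong p≗q xs = trans (count≡sum _ xs) (trans (cong sum (map-cong (cong iverson ∘ p≗q) xs)) (sym (count≡sum _ xs)))

  count-false : ∀ (xs : List A) → count (λ _ → false) xs ≡ 0
  count-false []       = refl
  count-false (x ∷ xs) = count-false xs

  count-+ : ∀ {p q r : A → Bool} → (∀ x → iverson (p x) ≡ iverson (q x) + iverson (r x))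
          → ∀ xs → count p xs ≡ count q xs + count r xs
  count-+ split [] = refl
  count-+ {p} {q} {r} split (x ∷ xs) = begin
    count p (x ∷ xs)                                             ≡⟨ count-∷ p x xs ⟩
    iverson (p x) + count p xs                                   ≡⟨ cong₂ _+_ (split x) (count-+ split xs) ⟩
    (iverson (q x) + iverson (r x)) + (count q xs + count r xs)  ≡⟨ interchange (iverson (q x)) (iverson (r x)) (count q xs) (count r xs) ⟩
    (iverson (q x) + count q xs) + (iverson (r x) + count r xs)  ≡⟨ sym (cong₂ _+_ (count-∷ q x xs) (count-∷ r x xs)) ⟩
    count q (x ∷ xs) + count r (x ∷ xs)                          ∎
    where open ≡-Reasoning

  count≡0⇒false : ∀ {p : A → Bool} {xs y} → count p xs ≡ 0 → y ∈ xs → p y ≡ false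
  count≡0⇒false {p} {x ∷ xs} c≡0 (here refl) with p x | c≡0
  ... | false | _ = refl
  count≡0⇒false {p} {x ∷ xs} c≡0 (there y∈) with p x | c≡0
  ... | false | c≡0′ = count≡0⇒false c≡0′ y∈

  count≡1-unique : ∀ {p : A → Bool} {xs x y} → count p xs ≡ 1 → x ∈ xs → y ∈ xs
                 → p x ≡ true → p y ≡ true → x ≡ y
  count≡1-unique _ (here refl) (here refl) _ _ = refl
  count≡1-unique {p} {z ∷ xs} c (here refl) (there y∈) px py with p z | c
  ... | true  | c′ = contradiction (trans (sym py) (count≡0⇒false (suc-injective c′) y∈)) λ ()
  count≡1-unique c x∈@(there _) y∈@(here refl) px py = sym (count≡1-unique c y∈ x∈ py px)
  count≡1-unique {p} {z ∷ xs} c (there x∈) (there y∈) px py with p z | c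
  ... | true  | c′ = contradiction (trans (sym px) (count≡0⇒false (suc-injective c′) x∈)) λ ()
  ... | false | c′ = count≡1-unique c′ x∈ y∈ px py

  sum-map-+ : ∀ (f g : A → ℕ) xs → sum (map (λ x → f x + g x) xs) ≡ sum (map f xs) + sum (map g xs)
  sum-map-+ f g []       = refl
  sum-map-+ f g (x ∷ xs) =
    trans (cong (f x + g x +_) (sum-map-+ f g xs)) (interchange (f x) (g x) (sum (map f xs)) (sum (map g xs)))

  sum-map-0 : ∀ (xs : List A) → sum (map (λ _ → 0) xs) ≡ 0
  sum-map-0 []       = refl
  sum-map-0 (x ∷ xs) = sum-map-0 xs

module _ {A B : Set} where

  count-swap : ∀ (r : A → B → Bool) xs ys →
    sum (map (λ x → count (r x) ys) xs) ≡ sum (map (λ y → count (λ x → r x y) xs) ys)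
  count-swap r []       ys = sym (sum-map-0 ys)
  count-swap r (x ∷ xs) ys = begin
    count (r x) ys + sum (map (λ x → count (r x) ys) xs)
      ≡⟨ cong₂ _+_ (count≡sum (r x) ys) (count-swap r xs ys) ⟩
    sum (map (iverson ∘ r x) ys) + sum (map (λ y → count (λ x → r x y) xs) ys)
      ≡⟨ sum-map-+ (iverson ∘ r x) (λ y → count (λ x → r x y) xs) ys ⟨
    sum (map (λ y → iverson (r x y) + count (λ x → r x y) xs) ys)
      ≡⟨ cong sum (map-cong (λ y → sym (count-∷ (λ x → r x y) x xs)) ys) ⟩
    sum (map (λ y → count (λ x → r x y) (x ∷ xs)) ys) ∎
    where open ≡-Reasoning

count-below : ∀ k m → count (_<ᵇ k) (downFrom m) ≡ m ⊓ k
count-below k zero = refl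
count-below k (suc m) with m <ᵇ k | <ᵇ-reflects-< m k
... | true  | ofʸ m<k = trans (cong suc (trans (count-below k m) (m≤n⇒m⊓n≡m (<⇒≤ m<k)))) (sym (m≤n⇒m⊓n≡m m<k))
... | false | ofⁿ m≮k = trans (count-below k m) (trans (m≥n⇒m⊓n≡n k≤m) (sym (m≥n⇒m⊓n≡n (m≤n⇒m≤1+n k≤m))))
  where k≤m = ≮⇒≥ m≮k

count-below-≤ : ∀ {k m} → k ≤ m → count (_<ᵇ k) (downFrom m) ≡ k
count-below-≤ {k} {m} k≤m = trans (count-below k m) (m≥n⇒m⊓n≡n k≤m)

count-above : ∀ k m → count (k <ᵇ_) (downFrom m) ≡ m ∸ suc k
count-above k zero = refl
count-above k (suc m) with k <ᵇ m | <ᵇ-reflects-< k m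
... | true  | ofʸ k<m = trans (cong suc (count-above k m)) (sym (+-∸-assoc 1 k<m))
... | false | ofⁿ k≮m = trans (count-above k m) (trans (m≤n⇒m∸n≡0 (m≤n⇒m≤1+n m≤k)) (sym (m≤n⇒m∸n≡0 m≤k)))
  where m≤k = ≮⇒≥ k≮m

count-≡ᵇ : ∀ {x m} → x < m → count (_≡ᵇ x) (downFrom m) ≡ 1
count-≡ᵇ {x} {m} x<m = +-cancelˡ-≡ x _ _ (begin
  x + count (_≡ᵇ x) (downFrom m)
    ≡⟨ cong (_+ count (_≡ᵇ x) (downFrom m)) (count-below-≤ (<⇒≤ x<m)) ⟨
  count (_<ᵇ x) (downFrom m) + count (_≡ᵇ x) (downFrom m)
    ≡⟨ count-+ split (downFrom m) ⟨
  count (_<ᵇ suc x) (downFrom m)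
    ≡⟨ count-below-≤ x<m ⟩
  suc x
    ≡⟨ +-comm 1 x ⟩
  x + 1 ∎)
  where
  open ≡-Reasoning
  split : ∀ v → iverson (v <ᵇ suc x) ≡ iverson (v <ᵇ x) + iverson (v ≡ᵇ x)
  split v with <-cmp v x
  ... | tri< v<x _ _ rewrite <ᵇ-true v<x | <ᵇ-true (m≤n⇒m≤1+n v<x) | ≡ᵇ-false (<⇒≢ v<x) = refl
  ... | tri≈ _ refl _ rewrite <ᵇ-false (≤-refl {v}) | <ᵇ-true (n<1+n v) | ≡ᵇ-refl v = refl
  ... | tri> _ _ x<v rewrite <ᵇ-false (<⇒≤ x<v) | <ᵇ-false {v} {suc x} x<v | ≡ᵇ-false (≢-sym (<⇒≢ x<v)) = refl

count-point : ∀ (A : ℕ → Bool) {x m} → x < m → count (λ v → A v ∧ (v ≡ᵇ x)) (downFrom m) ≡ iverson (A x)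
count-point A {x} {m} x<m = trans (count-cong at-x (downFrom m)) (only-x (A x))
  where
  at-x : ∀ v → (A v ∧ (v ≡ᵇ x)) ≡ (A x ∧ (v ≡ᵇ x))
  at-x v with v ≡ᵇ x | ≡ᵇ-reflects-≡ v x
  ... | true  | ofʸ refl = refl
  ... | false | _        = trans (∧-zeroʳ (A v)) (sym (∧-zeroʳ (A x)))
  only-x : ∀ b → count (λ v → b ∧ (v ≡ᵇ x)) (downFrom m) ≡ iverson b
  only-x true  = count-≡ᵇ x<m
  only-x false = count-false (downFrom m)

count-pair : ∀ (A : ℕ → Bool) {x y m} → x ≢ y → x < m → y < m →
  count (λ v → A v ∧ ((v ≡ᵇ x) ∨ (v ≡ᵇ y))) (downFrom m) ≡ iverson (A x) + iverson (A y)
count-pair A {x} {y} {m} x≢y x<m y<m =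
  trans (count-+ split (downFrom m)) (cong₂ _+_ (count-point A x<m) (count-point A y<m))
  where
  split : ∀ v → iverson (A v ∧ ((v ≡ᵇ x) ∨ (v ≡ᵇ y))) ≡ iverson (A v ∧ (v ≡ᵇ x)) + iverson (A v ∧ (v ≡ᵇ y))
  split v with A v | v ≡ᵇ x | ≡ᵇ-reflects-≡ v x
  ... | false | _     | _        = refl
  ... | true  | false | _        = refl
  ... | true  | true  | ofʸ refl rewrite ≡ᵇ-false x≢y = refl

between outside : ℕ → ℕ → ℕ → Bool
between a b v = (a <ᵇ v) ∧ (v <ᵇ b)
outside a b v = (v <ᵇ a) ∨ (b <ᵇ v)

count-between : ∀ {a b m} → a < b → b ≤ m → count (between a b) (downFrom m) ≡ b ∸ suc a
count-between {a} {b} {m} a<b b≤m = sym (begin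
  b ∸ suc a                                         ≡⟨ cong (_∸ suc a) b≡ ⟩
  suc a + count (between a b) (downFrom m) ∸ suc a  ≡⟨ m+n∸m≡n (suc a) _ ⟩
  count (between a b) (downFrom m)                  ∎)
  where
  open ≡-Reasoning
  split : ∀ v → iverson (v <ᵇ b) ≡ iverson (v <ᵇ suc a) + iverson (between a b v)
  split v with a <ᵇ v | <ᵇ-reflects-< a v
  ... | true  | ofʸ a<v rewrite <ᵇ-false {v} {suc a} a<v = refl
  ... | false | ofⁿ a≮v rewrite <ᵇ-true {v} {suc a} (s≤s (≮⇒≥ a≮v)) | <ᵇ-true (≤-<-trans (≮⇒≥ a≮v) a<b) = refl
  b≡ : b ≡ suc a + count (between a b) (downFrom m)
  b≡ = begin
    b
      ≡⟨ count-below-≤ b≤m ⟨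
    count (_<ᵇ b) (downFrom m)
      ≡⟨ count-+ split (downFrom m) ⟩
    count (_<ᵇ suc a) (downFrom m) + count (between a b) (downFrom m)
      ≡⟨ cong (_+ count (between a b) (downFrom m)) (count-below-≤ (≤-trans a<b b≤m)) ⟩
    suc a + count (between a b) (downFrom m) ∎

count-outside : ∀ {a b m} → a < b → b < m → count (outside a b) (downFrom m) ≡ a + (m ∸ suc b)
count-outside {a} {b} {m} a<b b<m = begin
  count (outside a b) (downFrom m)                          ≡⟨ count-+ split (downFrom m) ⟩
  count (_<ᵇ a) (downFrom m) + count (b <ᵇ_) (downFrom m)  ≡⟨ cong₂ _+_ (count-below-≤ a≤m) (count-above b m) ⟩
  a + (m ∸ suc b)                                           ∎
  where
  open ≡-Reasoning
  a≤m = <⇒≤ (<-trans a<b b<m)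
  split : ∀ v → iverson (outside a b v) ≡ iverson (v <ᵇ a) + iverson (b <ᵇ v)
  split v with v <ᵇ a | <ᵇ-reflects-< v a
  ... | true  | ofʸ v<a rewrite <ᵇ-false {b} {v} (<⇒≤ (<-trans v<a a<b)) = refl
  ... | false | _ = refl

incident : ∀ {n} → ℕ → Edge n → Bool
incident v (x , y) = (v ≡ᵇ val x) ∨ (v ≡ᵇ val y)

EndpointsAgree : ∀ {n} → (ℕ → Bool) → (Edge n → Bool) → Edge n → Set
EndpointsAgree A S (x , y) = (A (val x) ≡ S (x , y)) × (A (val y) ≡ S (x , y))

-- Count the incidences between labels in A and edges of N in two ways: each label lies on
-- exactly one edge, and each edge has either both or none of its endpoints in A.
double-counting : ∀ {n} {N : List (Edge n)} (A : ℕ → Bool) (S : Edge n → Bool)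
  → All (λ e → val (proj₁ e) < val (proj₂ e)) N → (∀ p → count (touches p) N ≡ 1)
  → All (EndpointsAgree A S) N → count A (downFrom (2 * n)) ≡ 2 * count S N
double-counting {n} {N} A S ordered perfect agree = begin
  count A labels
    ≡⟨ count≡sum A labels ⟩
  sum (map (iverson ∘ A) labels)
    ≡⟨ cong sum (map-cong-local (applyDownFrom⁺₁ id (2 * n) (sym ∘ at-label))) ⟩
  sum (map (λ v → count (λ g → A v ∧ incident v g) N) labels)
    ≡⟨ count-swap (λ v g → A v ∧ incident v g) labels N ⟩
  sum (map (λ g → count (λ v → A v ∧ incident v g) labels) N)
    ≡⟨ cong sum (map-cong-local (All.zipWith (λ (x<y , ag) → at-edge x<y ag) (ordered , agree))) ⟩
  sum (map (λ g → iverson (S g) + iverson (S g)) N)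
    ≡⟨ sum-map-+ (iverson ∘ S) (iverson ∘ S) N ⟩
  sum (map (iverson ∘ S) N) + sum (map (iverson ∘ S) N)
    ≡⟨ cong₂ _+_ (count≡sum S N) (count≡sum S N) ⟨
  count S N + count S N
    ≡⟨ cong (count S N +_) (+-identityʳ (count S N)) ⟨
  2 * count S N ∎
  where
  open ≡-Reasoning
  labels = downFrom (2 * n)
  at-label : ∀ {v} → v < 2 * n → count (λ g → A v ∧ incident v g) N ≡ iverson (A v)
  at-label {v} v<2n with A v
  ... | true  = subst (λ w → count (incident w) N ≡ 1) (toℕ-fromℕ< v<2n) (perfect (pt (fromℕ< v<2n)))
  ... | false = count-false N
  at-edge : ∀ {g} → val (proj₁ g) < val (proj₂ g) → EndpointsAgree A S g
          → count (λ v → A v ∧ incident v g) labels ≡ iverson (S g) + iverson (S g)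
  at-edge {x , y} x<y (Ax , Ay) =
    trans (count-pair A (<⇒≢ x<y) (toℕ<n (Point.label x)) (toℕ<n (Point.label y))) (cong₂ _+_ (cong iverson Ax) (cong iverson Ay))

data Side (a b v : ℕ) : Set where
  below  : v < a → Side a b v
  within : a < v → v < b → Side a b v
  above  : b < v → Side a b v

side : ∀ {a b v} → a < b → a ≢ v → b ≢ v → Side a b v
side {a} {b} {v} a<b a≢v b≢v with <-cmp v a | <-cmp v b
... | tri< v<a _ _ | _            = below v<a
... | tri≈ _ v≡a _ | _            = contradiction (sym v≡a) a≢v
... | tri> _ _ a<v | tri< v<b _ _ = within a<v v<b
... | tri> _ _ _   | tri≈ _ v≡b _ = contradiction (sym v≡b) b≢v
... | tri> _ _ _   | tri> _ _ b<v = above b<v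

OnOneSide : ∀ {n} → Edge n → Edge n → Set
OnOneSide (a , b) g = EndpointsAgree (between (val a) (val b)) (strictlyInside (a , b)) g
                    × EndpointsAgree (outside (val a) (val b)) (strictlyOutside (a , b)) g

touches-fst : ∀ {n} (a b : Point n) → touches a (a , b) ≡ true
touches-fst a b = cong (_∨ (val a ≡ᵇ val b)) (≡ᵇ-refl (val a))

touches-snd : ∀ {n} (a b : Point n) → touches b (a , b) ≡ true
touches-snd a b = trans (cong ((val b ≡ᵇ val a) ∨_) (≡ᵇ-refl (val b))) (∨-zeroʳ _)

touches-false : ∀ {n} {p x y : Point n} → touches p (x , y) ≡ false → val p ≢ val x × val p ≢ val y
touches-false t with ∨-false t
... | px , py = ≡ᵇ-false⇒≢ px , ≡ᵇ-false⇒≢ py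

on-one-side-self : ∀ {n} {a b : Point n} → val a < val b → OnOneSide (a , b) (a , b)
on-one-side-self {a = a} {b} a<b
  rewrite <ᵇ-false (≤-refl {val a}) | <ᵇ-false (≤-refl {val b}) | <ᵇ-true a<b | <ᵇ-false (<⇒≤ a<b)
  = (refl , refl) , (refl , refl)

on-one-side-disjoint : ∀ {n} {a b x y : Point n} → val a < val b → val x < val y → ¬ Cross (a , b) (x , y)
  → touches a (x , y) ≡ false → touches b (x , y) ≡ false → OnOneSide (a , b) (x , y)
on-one-side-disjoint {a = a} {b} {x} {y} a<b x<y ¬cross ta tb
  with side a<b (proj₁ (touches-false {p = a} ta)) (proj₁ (touches-false {p = b} tb))
     | side a<b (proj₂ (touches-false {p = a} ta)) (proj₂ (touches-false {p = b} tb))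
... | below x<a | below y<a
  rewrite <ᵇ-false (<⇒≤ x<a) | <ᵇ-false (<⇒≤ y<a) | <ᵇ-true x<a | <ᵇ-true y<a
  = (refl , refl) , (refl , refl)
... | below x<a | within a<y y<b = contradiction (inj₂ (x<a , a<y , y<b)) ¬cross
... | below x<a | above b<y
  rewrite <ᵇ-false (<⇒≤ x<a) | <ᵇ-true x<a | <ᵇ-false (<⇒≤ b<y) | <ᵇ-true b<y
        | <ᵇ-true (<-trans a<b b<y) | <ᵇ-false (<⇒≤ (<-trans a<b b<y)) | <ᵇ-false (<⇒≤ (<-trans x<a a<b))
  = (refl , refl) , (refl , refl)
... | within a<x x<b | below y<a = contradiction (<-trans y<a a<x) (<⇒≯ x<y)
... | within a<x x<b | within a<y y<b
  rewrite <ᵇ-true a<x | <ᵇ-true x<b | <ᵇ-true a<y | <ᵇ-true y<b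
        | <ᵇ-false (<⇒≤ a<x) | <ᵇ-false (<⇒≤ x<b) | <ᵇ-false (<⇒≤ a<y) | <ᵇ-false (<⇒≤ y<b)
  = (refl , refl) , (refl , refl)
... | within a<x x<b | above b<y = contradiction (inj₁ (a<x , x<b , b<y)) ¬cross
... | above b<x | below y<a = contradiction (<-trans y<a (<-trans a<b b<x)) (<⇒≯ x<y)
... | above b<x | within a<y y<b = contradiction (<-trans y<b b<x) (<⇒≯ x<y)
... | above b<x | above b<y
  rewrite <ᵇ-true (<-trans a<b b<x) | <ᵇ-false (<⇒≤ b<x) | <ᵇ-true (<-trans a<b b<y) | <ᵇ-false (<⇒≤ b<y)
        | <ᵇ-false (<⇒≤ (<-trans a<b b<x)) | <ᵇ-true b<x | <ᵇ-false (<⇒≤ (<-trans a<b b<y)) | <ᵇ-true b<y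
  = (refl , refl) , (refl , refl)

-- A chord of span s among 2n points whose two open arcs contain 2i and 2o points.
record ChordSplit (n s i o : ℕ) : Set where
  constructor splits
  field
    inside-span  : s ≡ suc (2 * i)
    outside-span : 2 * n ∸ s ≡ suc (2 * o)
open ChordSplit

arc-complement : ∀ {a b m} → a ≤ b → b < m → m ∸ (b ∸ a) ≡ suc (a + (m ∸ suc b))
arc-complement {a} {b} {m} a≤b b<m = begin
  m ∸ (b ∸ a)                                ≡⟨ cong (_∸ (b ∸ a)) m≡ ⟩
  (b ∸ a) + suc (a + (m ∸ suc b)) ∸ (b ∸ a)  ≡⟨ m+n∸m≡n (b ∸ a) _ ⟩
  suc (a + (m ∸ suc b))                      ∎
  where
  open ≡-Reasoning
  shuffle : ∀ d a r → suc (d + a) + r ≡ d + suc (a + r)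
  shuffle = solve-∀
  m≡ : m ≡ (b ∸ a) + suc (a + (m ∸ suc b))
  m≡ = begin
    m                                ≡⟨ m+[n∸m]≡n b<m ⟨
    suc b + (m ∸ suc b)              ≡⟨ cong (λ c → suc c + (m ∸ suc b)) (m∸n+n≡m a≤b) ⟨
    suc ((b ∸ a) + a) + (m ∸ suc b)  ≡⟨ shuffle (b ∸ a) a (m ∸ suc b) ⟩
    (b ∸ a) + suc (a + (m ∸ suc b))  ∎

module _ {n} {N : List (Edge n)} (nc : IsNCMatching n N) where
  open IsNCMatching nc

  on-one-side : ∀ {e g} → e ∈ N → g ∈ N → OnOneSide e g
  on-one-side {a , b} {x , y} e∈N g∈N with touches a (x , y) in ta | touches b (x , y) in tb
  ... | true  | _     = subst (OnOneSide (a , b)) (count≡1-unique (perfect a) e∈N g∈N (touches-fst a b) ta)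
                          (on-one-side-self {n} (All.lookup ordered e∈N))
  ... | false | true  = subst (OnOneSide (a , b)) (count≡1-unique (perfect b) e∈N g∈N (touches-snd a b) tb)
                          (on-one-side-self {n} (All.lookup ordered e∈N))
  ... | false | false =
    on-one-side-disjoint {n} (All.lookup ordered e∈N) (All.lookup ordered g∈N) (noncrossing e∈N g∈N) ta tb

  chord-split : ∀ {a b} → (a , b) ∈ N →
    ChordSplit n (val b ∸ val a) (count (strictlyInside (a , b)) N) (count (strictlyOutside (a , b)) N)
  chord-split {a} {b} e∈N = splits
    (trans (+-∸-assoc 1 a<b) (cong suc (sym twice-inside)))
    (trans (arc-complement (<⇒≤ a<b) b<2n) (cong suc (sym twice-outside)))
    where
    a<b = All.lookup ordered e∈N
    b<2n = toℕ<n (Point.label b)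
    sides = All.tabulate (on-one-side e∈N)
    twice-inside : 2 * count (strictlyInside (a , b)) N ≡ val b ∸ suc (val a)
    twice-inside = trans (sym (double-counting _ _ ordered perfect (All.map proj₁ sides))) (count-between a<b (<⇒≤ b<2n))
    twice-outside : 2 * count (strictlyOutside (a , b)) N ≡ val a + (2 * n ∸ suc (val b))
    twice-outside = trans (sym (double-counting _ _ ordered perfect (All.map proj₂ sides))) (count-outside a<b b<2n)

split-bound : ∀ {n s i o} → ChordSplit n s i o → s < 2 * n
split-bound (splits _ o≡) = m∸n≢0⇒n<m (λ e → 0≢1+n (trans (sym e) o≡))

split-size : ∀ {n s i o} → ChordSplit n s i o → suc (i + o) ≡ n
split-size {n} {s} {i} {o} sp@(splits s≡ o≡) = *-cancelˡ-≡ (suc (i + o)) n 2 (begin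
  2 * suc (i + o)            ≡⟨ double i o ⟨
  suc (2 * i) + suc (2 * o)  ≡⟨ cong₂ _+_ s≡ o≡ ⟨
  s + (2 * n ∸ s)            ≡⟨ m+[n∸m]≡n (<⇒≤ (split-bound sp)) ⟩
  2 * n                      ∎)
  where
  open ≡-Reasoning
  double : ∀ i o → suc (2 * i) + suc (2 * o) ≡ 2 * suc (i + o)
  double = solve-∀

split-mirror : ∀ {n s i o} → ChordSplit n s i o → ChordSplit n (2 * n ∸ s) o i
split-mirror sp@(splits s≡ o≡) = splits o≡ (trans (m∸[m∸n]≡n (<⇒≤ (split-bound sp))) s≡)

split-centered : ∀ {n s i o} → ChordSplit n s i o → (s ≤ n ⇔ i ⊓ o ≡ i)
split-centered {n} {s} {i} {o} sp@(splits s≡ _) = mk⇔ (m≤n⇒m⊓n≡m ∘ to) (from ∘ m⊓n≡m⇒m≤n)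
  where
  n≡ : n ≡ suc (i + o)
  n≡ = sym (split-size sp)
  to : s ≤ n → i ≤ o
  to s≤n = subst (_≤ o) (+-identityʳ i) (+-cancelˡ-≤ i _ o (s≤s⁻¹ (subst₂ _≤_ s≡ n≡ s≤n)))
  from : i ≤ o → s ≤ n
  from i≤o = subst₂ _≤_ (sym s≡) (sym n≡) (s≤s (+-monoʳ-≤ i (subst (_≤ o) (sym (+-identityʳ i)) i≤o)))

+-tight : ∀ {m n o p} → m ≤ n → o ≤ p → m + o ≡ n + p → m ≡ n × o ≡ p
+-tight {m} {n} {o} {p} m≤n o≤p eq = ≤-antisym m≤n n≤m , ≤-antisym o≤p p≤o
  where
  n≤m = +-cancelʳ-≤ p n m (subst (_≤ m + p) eq (+-monoʳ-≤ m o≤p))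
  p≤o = +-cancelˡ-≤ n p o (subst (_≤ n + o) eq (+-monoˡ-≤ o m≤n))

¬⇔< : ∀ {C : Set} {s t} → s ≤ t → C ⇔ (s ≡ t) → (¬ C) ⇔ (s < t)
¬⇔< s≤t C⇔ = mk⇔ (λ ¬c → ≤∧≢⇒< s≤t (¬c ∘ Equivalence.from C⇔)) (λ s<t c → <⇒≢ s<t (Equivalence.to C⇔ c))

CenteringCriterion : ℕ → Set → ℕ → Set
CenteringCriterion n C S = (C ⇔ (S ≡ n ∸ 2)) × ((¬ C) ⇔ (S < n ∸ 2))

four-arcs : ∀ {n d₁ d₂ d₃ d₄ x₁ x₂ x₃ x₄ y₁ y₂ y₃ y₄} →
  ChordSplit n d₁ x₁ y₁ → ChordSplit n d₂ x₂ y₂ → ChordSplit n d₃ x₃ y₃ → ChordSplit n d₄ x₄ y₄ →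
  d₁ + (d₂ + (d₃ + d₄)) ≡ 2 * n →
  CenteringCriterion n (d₁ ≤ n × d₂ ≤ n × d₃ ≤ n × d₄ ≤ n) (x₁ ⊓ y₁ + (x₂ ⊓ y₂ + (x₃ ⊓ y₃ + x₄ ⊓ y₄)))
four-arcs {n} {d₁} {d₂} {d₃} {d₄} {x₁} {x₂} {x₃} {x₄} {y₁} {y₂} {y₃} {y₄} sp₁ sp₂ sp₃ sp₄ Σd = C⇔ , ¬⇔< S≤ C⇔
  where
  open ≡-Reasoning
  odd-sum : ∀ a b c d → suc (2 * a) + (suc (2 * b) + (suc (2 * c) + suc (2 * d))) ≡ 2 * suc (suc (a + (b + (c + d))))
  odd-sum = solve-∀
  Σx : x₁ + (x₂ + (x₃ + x₄)) ≡ n ∸ 2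
  Σx = cong (_∸ 2) (*-cancelˡ-≡ (suc (suc (x₁ + (x₂ + (x₃ + x₄))))) n 2 (begin
    2 * suc (suc (x₁ + (x₂ + (x₃ + x₄))))
      ≡⟨ odd-sum x₁ x₂ x₃ x₄ ⟨
    suc (2 * x₁) + (suc (2 * x₂) + (suc (2 * x₃) + suc (2 * x₄)))
      ≡⟨ cong₂ _+_ (inside-span sp₁) (cong₂ _+_ (inside-span sp₂) (cong₂ _+_ (inside-span sp₃) (inside-span sp₄))) ⟨
    d₁ + (d₂ + (d₃ + d₄))
      ≡⟨ Σd ⟩
    2 * n ∎))
  C = d₁ ≤ n × d₂ ≤ n × d₃ ≤ n × d₄ ≤ n
  S = x₁ ⊓ y₁ + (x₂ ⊓ y₂ + (x₃ ⊓ y₃ + x₄ ⊓ y₄))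
  ℓ≤₁ = m⊓n≤m x₁ y₁
  ℓ≤₂ = m⊓n≤m x₂ y₂
  ℓ≤₃ = m⊓n≤m x₃ y₃
  ℓ≤₄ = m⊓n≤m x₄ y₄
  S≤ : S ≤ n ∸ 2
  S≤ = subst (S ≤_) Σx (+-mono-≤ ℓ≤₁ (+-mono-≤ ℓ≤₂ (+-mono-≤ ℓ≤₃ ℓ≤₄)))
  tight : ∀ {d x y} → ChordSplit n d x y → d ≤ n → x ⊓ y ≡ x
  tight sp = Equivalence.to (split-centered sp)
  loose : ∀ {d x y} → ChordSplit n d x y → x ⊓ y ≡ x → d ≤ n
  loose sp = Equivalence.from (split-centered sp)
  C⇔ : C ⇔ (S ≡ n ∸ 2)
  C⇔ = mk⇔ to from
    where
    to : C → S ≡ n ∸ 2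
    to (c₁ , c₂ , c₃ , c₄) =
      trans (cong₂ _+_ (tight sp₁ c₁) (cong₂ _+_ (tight sp₂ c₂) (cong₂ _+_ (tight sp₃ c₃) (tight sp₄ c₄)))) Σx
    from : S ≡ n ∸ 2 → C
    from S≡ with +-tight ℓ≤₁ (+-mono-≤ ℓ≤₂ (+-mono-≤ ℓ≤₃ ℓ≤₄)) (trans S≡ (sym Σx))
    ... | e₁ , e₂₃₄ with +-tight ℓ≤₂ (+-mono-≤ ℓ≤₃ ℓ≤₄) e₂₃₄
    ... | e₂ , e₃₄ with +-tight ℓ≤₃ ℓ≤₄ e₃₄
    ... | e₃ , e₄ = loose sp₁ e₁ , loose sp₂ e₂ , loose sp₃ e₃ , loose sp₄ e₄

∸-telescope : ∀ {a b c} → a ≤ b → b ≤ c → (b ∸ a) + (c ∸ b) ≡ c ∸ a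
∸-telescope {a} {b} {c} a≤b b≤c = trans (+-comm (b ∸ a) (c ∸ b))
  (sym (trans (cong (_∸ a) (sym (m∸n+n≡m b≤c))) (+-∸-assoc (c ∸ b) a≤b)))

↭-head∈ : ∀ {A : Set} {xs : List A} {x y zs} → xs ↭ x ∷ y ∷ zs → x ∈ xs
↭-head∈ xs↭ = ∈-resp-↭ (↭-sym xs↭) (here refl)

↭-second∈ : ∀ {A : Set} {xs : List A} {x y zs} → xs ↭ x ∷ y ∷ zs → y ∈ xs
↭-second∈ xs↭ = ∈-resp-↭ (↭-sym xs↭) (there (here refl))

quadrilateral : ∀ {n} {N₁ N₂ : List (Edge n)} {p₁ p₂ p₃ p₄ : Point n} → IsNCMatching n N₁ → IsNCMatching n N₂
  → val p₁ < val p₂ → val p₂ < val p₃ → val p₃ < val p₄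
  → (p₁ , p₂) ∈ N₂ → (p₂ , p₃) ∈ N₁ → (p₃ , p₄) ∈ N₂ → (p₁ , p₄) ∈ N₁
  → CenteringCriterion n
      ((val p₂ ∸ val p₁ ≤ n) × (val p₃ ∸ val p₂ ≤ n) × (val p₄ ∸ val p₃ ≤ n) × (2 * n ∸ (val p₄ ∸ val p₁) ≤ n))
      (len N₂ (p₁ , p₂) + (len N₁ (p₂ , p₃) + (len N₂ (p₃ , p₄) + len N₁ (p₁ , p₄))))
quadrilateral {n} {N₁} {N₂} {p₁} {p₂} {p₃} {p₄} nc₁ nc₂ p₁<p₂ p₂<p₃ p₃<p₄ e₁₂ e₂₃ e₃₄ e₁₄ =
  subst (CenteringCriterion n _) (cong (λ ℓ → len N₂ (p₁ , p₂) + (len N₁ (p₂ , p₃) + (len N₂ (p₃ , p₄) + ℓ))) (⊓-comm _ _))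
    (four-arcs (chord-split nc₂ e₁₂) (chord-split nc₁ e₂₃) (chord-split nc₂ e₃₄) (split-mirror sp₁₄) arcs)
  where
  -- the fourth arc, from p₄ round to p₁, is the outer side of the chord p₁p₄
  sp₁₄ = chord-split nc₁ e₁₄
  d₁₂ = val p₂ ∸ val p₁
  d₂₃ = val p₃ ∸ val p₂
  d₃₄ = val p₄ ∸ val p₃
  d₄₁ = 2 * n ∸ (val p₄ ∸ val p₁)
  arcs : d₁₂ + (d₂₃ + (d₃₄ + d₄₁)) ≡ 2 * n
  arcs = begin
    d₁₂ + (d₂₃ + (d₃₄ + d₄₁))        ≡⟨ trans (+-assoc (d₁₂ + d₂₃) d₃₄ d₄₁) (+-assoc d₁₂ d₂₃ (d₃₄ + d₄₁)) ⟨
    d₁₂ + d₂₃ + d₃₄ + d₄₁            ≡⟨ cong (λ d → d + d₃₄ + d₄₁) (∸-telescope (<⇒≤ p₁<p₂) (<⇒≤ p₂<p₃)) ⟩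
    (val p₃ ∸ val p₁) + d₃₄ + d₄₁    ≡⟨ cong (_+ d₄₁) (∸-telescope (<⇒≤ (<-trans p₁<p₂ p₂<p₃)) (<⇒≤ p₃<p₄)) ⟩
    (val p₄ ∸ val p₁) + d₄₁          ≡⟨ m+[n∸m]≡n (<⇒≤ (split-bound sp₁₄)) ⟩
    2 * n                            ∎
    where open ≡-Reasoning

lemma1 : (n : ℕ) → 2 ≤ n → (M M' : List (Edge n)) → IsNCMatching n M → IsNCMatching n M'
    → (fl : Flip M M')
    → ((Flip.Centered fl ⇔ (Flip.lengthSum fl ≡ n ∸ 2))
    × ((¬ Flip.Centered fl) ⇔ (Flip.lengthSum fl < n ∸ 2)))
lemma1 n _ M M' ncM ncM' fl with Flip.shape fl | Flip.old fl | Flip.new fl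
... | nested   | old | new =
  subst (CenteringCriterion n Centered) (nested-order (len M' (p₁ , p₂)) (len M (p₂ , p₃)) (len M' (p₃ , p₄)) (len M (p₁ , p₄)))
    (quadrilateral ncM ncM' p₁<p₂ p₂<p₃ p₃<p₄ (↭-head∈ new) (↭-second∈ old) (↭-second∈ new) (↭-head∈ old))
  where
  open Flip fl using (p₁; p₂; p₃; p₄; p₁<p₂; p₂<p₃; p₃<p₄; Centered)
  nested-order : ∀ a b c d → a + (b + (c + d)) ≡ (d + (b + 0)) + (a + (c + 0))
  nested-order = solve-∀
... | parallel | old | new =
  subst (CenteringCriterion n Centered) (parallel-order (len M (p₁ , p₂)) (len M' (p₂ , p₃)) (len M (p₃ , p₄)) (len M' (p₁ , p₄)))
    (quadrilateral ncM' ncM p₁<p₂ p₂<p₃ p₃<p₄ (↭-head∈ old) (↭-second∈ new) (↭-second∈ old) (↭-head∈ new))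
  where
  open Flip fl using (p₁; p₂; p₃; p₄; p₁<p₂; p₂<p₃; p₃<p₄; Centered)
  parallel-order : ∀ a b c d → a + (b + (c + d)) ≡ (a + (c + 0)) + (d + (b + 0))
  parallel-order = solve-∀
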